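{- A connected graph $G$ is a minimal $DD_2$-graph if and only if $G$ is a star $K_{1,n}$ with $n\ge 2$, a cycle $C_4$, or $G=S(H)$ for some connected corona multigraph $H$.
   Context: All graphs are finite and simple (multigraphs may have multiple edges). A set $D\subseteq V_G$ is dominating if every vertex of $V_G-D$ has a neighbor in $D$; it is 2-dominating if every vertex of $V_G-D$ has at least two neighbors in $D$. A $DD_2$-pair is a pair $(D,D_2)$ of disjoint vertex sets with $D$ dominating and $D_2$ 2-dominating; $G$ is a $DD_2$-graph if it has one. A connected graph $G$ is a minimal $DD_2$-graph if $G$ is a $DD_2$-graph and no proper spanning subgraph of $G$ is a $DD_2$-graph. A leaf is a vertex of degree one. A multigraph $H$ is a corona graph if every vertex of $H$ is a leaf or is adjacent to a leaf of $H$. The subdivision graph $S(H)$ of a multigraph $H$ is obtained from $H$ by inserting a new vertex onto each edge of $H$ (each of the parallel edges separately). -}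

module Defs where

open import Data.Nat as ℕ using (ℕ; zero; suc; _+_; _≤_; _%_; _≡ᵇ_)
open import Data.Fin as Fin using (Fin; zero; suc; toℕ; splitAt; _≟_)
open import Data.Bool using (Bool; true; false; _∨_; _∧_; not)
open import Data.Bool.Properties using (∨-comm)
open import Data.Sum using (_⊎_; inj₁; inj₂)
open import Data.Product using (Σ; ∃; ∃-syntax; _×_; _,_; proj₁; proj₂)
open import Relation.Nullary using (¬_)
open import Relation.Nullary.Decidable using (⌊_⌋)
open import Relation.Binary.PropositionalEquality using (_≡_; _≢_; refl)

record Graph (n : ℕ) : Set where
  field
    adj    : Fin n → Fin n → Bool
    sym    : ∀ u v → adj u v ≡ adj v u
    irrefl : ∀ v → adj v v ≡ false
open Graph public

data Walk {n : ℕ} (G : Graph n) : Fin n → Fin n → Set where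
  here : ∀ {v} → Walk G v v
  step : ∀ {u w v} → adj G u w ≡ true → Walk G w v → Walk G u v

Connected : ∀ {n} → Graph n → Set
Connected {n} G = (1 ≤ n) × (∀ u v → Walk G u v)

record _≅_ {n n' : ℕ} (G : Graph n) (G' : Graph n') : Set where
  field
    to       : Fin n → Fin n'
    from     : Fin n' → Fin n
    from∘to  : ∀ v → from (to v) ≡ v
    to∘from  : ∀ v → to (from v) ≡ v
    preserve : ∀ u v → adj G u v ≡ adj G' (to u) (to v)

VSet : ℕ → Set
VSet n = Fin n → Bool

Dominating : ∀ {n} → Graph n → VSet n → Set
Dominating G D = ∀ v → D v ≡ false → ∃[ u ] (D u ≡ true × adj G v u ≡ true)

TwoDominating : ∀ {n} → Graph n → VSet n → Set
TwoDominating G D = ∀ v → D v ≡ false →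
  ∃[ u ] ∃[ w ] (u ≢ w × D u ≡ true × D w ≡ true
                 × adj G v u ≡ true × adj G v w ≡ true)

Disjoint : ∀ {n} → VSet n → VSet n → Set
Disjoint D E = ∀ v → ¬ (D v ≡ true × E v ≡ true)

IsDD2Pair : ∀ {n} → Graph n → VSet n → VSet n → Set
IsDD2Pair G D D₂ = Disjoint D D₂ × Dominating G D × TwoDominating G D₂

IsDD2Graph : ∀ {n} → Graph n → Set
IsDD2Graph {n} G = Σ (VSet n) λ D → Σ (VSet n) λ D₂ → IsDD2Pair G D D₂

ProperSpanningSubgraph : ∀ {n} → Graph n → Graph n → Set
ProperSpanningSubgraph H G =
  (∀ u v → adj H u v ≡ true → adj G u v ≡ true)
  × ∃[ u ] ∃[ v ] (adj G u v ≡ true × adj H u v ≡ false)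

MinimalDD2Graph : ∀ {n} → Graph n → Set
MinimalDD2Graph {n} G =
  Connected G × IsDD2Graph G
  × (∀ (H : Graph n) → ProperSpanningSubgraph H G → ¬ IsDD2Graph H)

starAdj : ∀ {k} → Fin (suc k) → Fin (suc k) → Bool
starAdj zero    zero    = false
starAdj zero    (suc _) = true
starAdj (suc _) zero    = true
starAdj (suc _) (suc _) = false

star : (k : ℕ) → Graph (suc k)
star k = record { adj = starAdj ; sym = s ; irrefl = i }
  where
  s : ∀ u v → starAdj u v ≡ starAdj v u
  s zero zero = refl
  s zero (suc _) = refl
  s (suc _) zero = refl
  s (suc _) (suc _) = refl
  i : ∀ v → starAdj v v ≡ false
  i zero = refl
  i (suc _) = refl

c4Adj : Fin 4 → Fin 4 → Bool
c4Adj i j = (((toℕ i + 1) % 4) ≡ᵇ toℕ j) ∨ (((toℕ j + 1) % 4) ≡ᵇ toℕ i)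

C4 : Graph 4
C4 = record { adj = c4Adj ; sym = s ; irrefl = i }
  where
  s : ∀ u v → c4Adj u v ≡ c4Adj v u
  s u v = ∨-comm (((toℕ u + 1) % 4) ≡ᵇ toℕ v) (((toℕ v + 1) % 4) ≡ᵇ toℕ u)
  i : ∀ v → c4Adj v v ≡ false
  i zero = refl
  i (suc zero) = refl
  i (suc (suc zero)) = refl
  i (suc (suc (suc zero))) = refl

-- Finite multigraphs (parallel edges allowed, no loops):
-- vertices Fin m, edges Fin k, each edge has two distinct ends.

record Multigraph : Set where
  field
    m      : ℕ
    k      : ℕ
    ends   : Fin k → Fin m × Fin m
    noLoop : ∀ e → proj₁ (ends e) ≢ proj₂ (ends e)
open Multigraph public

Incident : (H : Multigraph) → Fin (m H) → Fin (k H) → Set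
Incident H v e = (proj₁ (ends H e) ≡ v) ⊎ (proj₂ (ends H e) ≡ v)

Joins : (H : Multigraph) → Fin (k H) → Fin (m H) → Fin (m H) → Set
Joins H e u v = ((proj₁ (ends H e) ≡ u) × (proj₂ (ends H e) ≡ v))
              ⊎ ((proj₁ (ends H e) ≡ v) × (proj₂ (ends H e) ≡ u))

MAdjacent : (H : Multigraph) → Fin (m H) → Fin (m H) → Set
MAdjacent H u v = ∃[ e ] Joins H e u v

MLeaf : (H : Multigraph) → Fin (m H) → Set
MLeaf H v = ∃[ e ] (Incident H v e × (∀ e' → Incident H v e' → e' ≡ e))

IsCorona : Multigraph → Set
IsCorona H = ∀ v → MLeaf H v ⊎ ∃[ u ] (MAdjacent H v u × MLeaf H u)

data MWalk (H : Multigraph) : Fin (m H) → Fin (m H) → Set where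
  here : ∀ {v} → MWalk H v v
  step : ∀ {u w v} → MAdjacent H u w → MWalk H w v → MWalk H u v

MConnected : Multigraph → Set
MConnected H = (1 ≤ m H) × (∀ u v → MWalk H u v)

-- Subdivision graph S(H) on Fin (m + k): the first m vertices are the
-- original vertices, the remaining k are the subdivision vertices, one per edge.

isEnd : (H : Multigraph) → Fin (m H) → Fin (k H) → Bool
isEnd H v e = ⌊ proj₁ (ends H e) ≟ v ⌋ ∨ ⌊ proj₂ (ends H e) ≟ v ⌋

sAdj' : (H : Multigraph) → Fin (m H) ⊎ Fin (k H) → Fin (m H) ⊎ Fin (k H) → Bool
sAdj' H (inj₁ v) (inj₂ e) = isEnd H v e
sAdj' H (inj₂ e) (inj₁ v) = isEnd H v e
sAdj' H (inj₁ _) (inj₁ _) = false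
sAdj' H (inj₂ _) (inj₂ _) = false

subdivision : (H : Multigraph) → Graph (m H + k H)
subdivision H = record
  { adj = λ x y → sAdj' H (splitAt (m H) x) (splitAt (m H) y)
  ; sym = λ x y → s (splitAt (m H) x) (splitAt (m H) y)
  ; irrefl = λ x → i (splitAt (m H) x) }
  where
  s : ∀ a b → sAdj' H a b ≡ sAdj' H b a
  s (inj₁ _) (inj₁ _) = refl
  s (inj₁ _) (inj₂ _) = refl
  s (inj₂ _) (inj₁ _) = refl
  s (inj₂ _) (inj₂ _) = refl
  i : ∀ a → sAdj' H a a ≡ false
  i (inj₁ _) = refl
  i (inj₂ _) = refl

-- In a minimal DD₂-graph with pair (D, D₂) every edge joins D₂ to its complement: otherwise
-- (V − D₂, D₂) survives the deletion of that edge. A vertex outside D₂ with three neighbours then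
-- forces a star. Otherwise every vertex outside D₂ has exactly two neighbours, so G = S(H) for the
-- multigraph H on D₂. If a vertex y of H is neither a leaf nor adjacent to one, either moving y out
-- of D₂ and its neighbours into it frees an edge, or y has a twin in D₂ (same neighbours), which
-- forces C₄.
-- Conversely, deleting an edge of S(H) leaves a midpoint pendant; its neighbour must lie in D, and
-- the nearest leaf of H then cannot be 2-dominated.

module Submission where

open import Defs hiding (sym)
open import Data.Nat using (ℕ; suc; _≤_)
open import Data.Product using (Σ; ∃-syntax; _×_)
open import Data.Sum using (_⊎_)
open import Function.Bundles using (_⇔_)

open import Data.Nat using (zero; z≤n; s≤s; _+_; >-nonZero⁻¹)
open import Data.Fin using (Fin; zero; suc; _≟_; splitAt; join; fromℕ<)
open import Data.Fin.Patterns using (0F; 1F; 2F; 3F)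
open import Data.Fin.Properties using (splitAt-join; join-splitAt; any?; all?; ¬∀⟶∃¬; nonZeroIndex)
import Data.Fin.Permutation.Components as Perm
open import Data.Bool using (Bool; true; false; _∧_; _∨_; not; if_then_else_)
import Data.Bool.Properties as Bool
open import Data.Bool.Properties using (∧-comm; ∨-comm; not-injective; ¬-not)
open import Data.Product using (_,_; proj₁; proj₂)
open import Data.Sum using (inj₁; inj₂; [_,_]; map₁; swap)
open import Data.Sum.Properties using (inj₁-injective; inj₂-injective; swap-involutive)
open import Data.Empty using (⊥; ⊥-elim)
open import Relation.Nullary using (¬_; Dec; yes; no)
open import Relation.Nullary.Decidable using (⌊_⌋; isYes≗does; dec-true; dec-false; _×-dec_; _⊎-dec_; _→-dec_; ¬?; True; toWitness)
open import Relation.Binary.PropositionalEquality hiding ([_])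
open import Function.Bundles using (mk⇔)

true≢false : true ≢ false
true≢false ()

∨-true⇒ : ∀ {a b} → a ∨ b ≡ true → a ≡ true ⊎ b ≡ true
∨-true⇒ {true}  _ = inj₁ refl
∨-true⇒ {false} h = inj₂ h

∧-true⇒ : ∀ {a b} → a ∧ b ≡ true → a ≡ true × b ≡ true
∧-true⇒ {true} {true} _ = refl , refl

≟-true⇒≡ : ∀ {n} {a b : Fin n} → ⌊ a ≟ b ⌋ ≡ true → a ≡ b
≟-true⇒≡ {a = a} {b} h with a ≟ b
... | yes a≡b = a≡b
... | no  _   = ⊥-elim (true≢false (sym h))

⌊⌋-yes : ∀ {A : Set} (a? : Dec A) → A → ⌊ a? ⌋ ≡ true
⌊⌋-yes a? a = trans (isYes≗does a?) (dec-true a? a)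

⌊⌋-no : ∀ {A : Set} (a? : Dec A) → ¬ A → ⌊ a? ⌋ ≡ false
⌊⌋-no a? ¬a = trans (isYes≗does a?) (dec-false a? ¬a)

complement-disjointˡ : ∀ {n} (S : VSet n) → Disjoint (λ v → not (S v)) S
complement-disjointˡ S v (s̄ , s) = true≢false (trans (sym s) (not-injective s̄))

complement-disjointʳ : ∀ {n} (S : VSet n) → Disjoint S (λ v → not (S v))
complement-disjointʳ S v (s , s̄) = complement-disjointˡ S v (s̄ , s)

SameEdge : ∀ {n} → Fin n → Fin n → Fin n → Fin n → Set
SameEdge a b u v = (u ≡ a × v ≡ b) ⊎ (u ≡ b × v ≡ a)

sameEdge? : ∀ {n} → Fin n → Fin n → Fin n → Fin n → Bool
sameEdge? a b u v = (⌊ u ≟ a ⌋ ∧ ⌊ v ≟ b ⌋) ∨ (⌊ u ≟ b ⌋ ∧ ⌊ v ≟ a ⌋)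

sameEdge?-sym : ∀ {n} (a b u v : Fin n) → sameEdge? a b u v ≡ sameEdge? a b v u
sameEdge?-sym a b u v =
  trans (∨-comm (⌊ u ≟ a ⌋ ∧ ⌊ v ≟ b ⌋) (⌊ u ≟ b ⌋ ∧ ⌊ v ≟ a ⌋))
        (cong₂ _∨_ (∧-comm ⌊ u ≟ b ⌋ ⌊ v ≟ a ⌋) (∧-comm ⌊ u ≟ a ⌋ ⌊ v ≟ b ⌋))

sameEdge?-complete : ∀ {n} (a b u v : Fin n) → SameEdge a b u v → sameEdge? a b u v ≡ true
sameEdge?-complete a b u v (inj₁ (refl , refl))
  rewrite ⌊⌋-yes (u ≟ u) refl | ⌊⌋-yes (v ≟ v) refl = refl
sameEdge?-complete a b u v (inj₂ (refl , refl))
  rewrite ⌊⌋-yes (u ≟ u) refl | ⌊⌋-yes (v ≟ v) refl = Bool.∨-zeroʳ _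

sameEdge?-sound : ∀ {n} (a b u v : Fin n) → sameEdge? a b u v ≡ true → SameEdge a b u v
sameEdge?-sound a b u v h with ∨-true⇒ {⌊ u ≟ a ⌋ ∧ ⌊ v ≟ b ⌋} h
... | inj₁ h₁ = let (p , q) = ∧-true⇒ h₁ in inj₁ (≟-true⇒≡ p , ≟-true⇒≡ q)
... | inj₂ h₂ = let (p , q) = ∧-true⇒ h₂ in inj₂ (≟-true⇒≡ p , ≟-true⇒≡ q)

deleteEdge : ∀ {n} → Graph n → Fin n → Fin n → Graph n
deleteEdge G a b = record
  { adj    = λ u v → adj G u v ∧ not (sameEdge? a b u v)
  ; sym    = λ u v → cong₂ (λ x y → x ∧ not y) (Graph.sym G u v) (sameEdge?-sym a b u v)
  ; irrefl = λ v → cong (λ x → x ∧ not (sameEdge? a b v v)) (irrefl G v) }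

module _ {n} (G : Graph n) (a b : Fin n) where

  deleteEdge-⊆ : ∀ u v → adj (deleteEdge G a b) u v ≡ true → adj G u v ≡ true
  deleteEdge-⊆ u v h = proj₁ (∧-true⇒ h)

  deleteEdge-removes : ∀ u v → adj (deleteEdge G a b) u v ≡ true → ¬ SameEdge a b u v
  deleteEdge-removes u v h e with sameEdge? a b u v | sameEdge?-complete a b u v e
  ... | true  | _ = true≢false (sym (proj₂ (∧-true⇒ {adj G u v} h)))
  ... | false | ()

  deleteEdge-keeps : ∀ u v → adj G u v ≡ true → ¬ SameEdge a b u v →
                     adj (deleteEdge G a b) u v ≡ true
  deleteEdge-keeps u v h ¬e with sameEdge? a b u v in eq
  ... | true  = ⊥-elim (¬e (sameEdge?-sound a b u v eq))
  ... | false rewrite h = refl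

  deleteEdge-keeps′ : ∀ u v → adj G u v ≡ true →
                      ¬ (u ≡ a × v ≡ b) → ¬ (u ≡ b × v ≡ a) → adj (deleteEdge G a b) u v ≡ true
  deleteEdge-keeps′ u v h ¬e₁ ¬e₂ = deleteEdge-keeps u v h λ { (inj₁ e) → ¬e₁ e ; (inj₂ e) → ¬e₂ e }

  deleteEdge-keeps-separated : ∀ {X : Set} (f : Fin n → X) → f a ≡ f b → ∀ u v → f u ≢ f v →
                               adj G u v ≡ true → adj (deleteEdge G a b) u v ≡ true
  deleteEdge-keeps-separated f fa≡fb u v fu≢fv h = deleteEdge-keeps′ u v h
    (λ { (refl , refl) → fu≢fv fa≡fb }) (λ { (refl , refl) → fu≢fv (sym fa≡fb) })

-- Minimality is edge-criticality

IsDD2Graph-transport : ∀ {n n'} (G₁ : Graph n) (G₂ : Graph n')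
  (to : Fin n → Fin n') (from : Fin n' → Fin n) →
  (∀ v → from (to v) ≡ v) → (∀ v → to (from v) ≡ v) →
  (∀ u v → adj G₁ u v ≡ true → adj G₂ (to u) (to v) ≡ true) →
  IsDD2Graph G₁ → IsDD2Graph G₂
IsDD2Graph-transport {n} {n'} G₁ G₂ to from from∘to to∘from hom (D , D₂ , dis , dom , dom₂) =
  D ∘from , D₂ ∘from , (λ v → dis (from v)) , dom′ , dom₂′
  where
  _∘from : VSet n → VSet n'
  (S ∘from) v = S (from v)
  member : ∀ (S : VSet n) {u} → S u ≡ true → (S ∘from) (to u) ≡ true
  member S {u} = subst (λ z → S z ≡ true) (sym (from∘to u))
  edge : ∀ v u → adj G₁ (from v) u ≡ true → adj G₂ v (to u) ≡ true
  edge v u h = subst (λ z → adj G₂ z (to u) ≡ true) (to∘from v) (hom _ _ h)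
  dom′ : Dominating G₂ (D ∘from)
  dom′ v v∉D = let (u , u∈D , vu) = dom (from v) v∉D in to u , member D u∈D , edge v u vu
  dom₂′ : TwoDominating G₂ (D₂ ∘from)
  dom₂′ v v∉D₂ =
    let (u , w , u≢w , u∈D₂ , w∈D₂ , vu , vw) = dom₂ (from v) v∉D₂ in
    to u , to w , (λ q → u≢w (trans (sym (from∘to u)) (trans (cong from q) (from∘to w)))) ,
    member D₂ u∈D₂ , member D₂ w∈D₂ , edge v u vu , edge v w vw

IsDD2Graph-mono : ∀ {n} (G₁ G₂ : Graph n) → (∀ u v → adj G₁ u v ≡ true → adj G₂ u v ≡ true) →
                  IsDD2Graph G₁ → IsDD2Graph G₂
IsDD2Graph-mono G₁ G₂ = IsDD2Graph-transport G₁ G₂ (λ v → v) (λ v → v) (λ _ → refl) (λ _ → refl)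

EdgeCritical : ∀ {n} → Graph n → Set
EdgeCritical {n} G = ∀ (a b : Fin n) → adj G a b ≡ true → ¬ IsDD2Graph (deleteEdge G a b)

EdgeMinimal : ∀ {n} → Graph n → Set
EdgeMinimal G = IsDD2Graph G × EdgeCritical G

minimal⇒edgeMinimal : ∀ {n} (G : Graph n) → MinimalDD2Graph G → EdgeMinimal G
minimal⇒edgeMinimal G (_ , dd , minimal) = dd , λ a b ab → minimal (deleteEdge G a b) (proper a b ab)
  where
  proper : ∀ a b → adj G a b ≡ true → ProperSpanningSubgraph (deleteEdge G a b) G
  proper a b ab = deleteEdge-⊆ G a b , a , b , ab ,
    ¬-not (λ q → deleteEdge-removes G a b a b q (inj₁ (refl , refl)))

edgeMinimal⇒minimal : ∀ {n} (G : Graph n) → Connected G → EdgeMinimal G → MinimalDD2Graph G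
edgeMinimal⇒minimal {n} G conn (dd , critical) = conn , dd , λ { H (H⊆G , a , b , ab , ¬Hab) ddH →
  critical a b ab (IsDD2Graph-mono H (deleteEdge G a b) (H⊆G−ab {H} H⊆G ¬Hab) ddH) }
  where
  H⊆G−ab : ∀ {H : Graph n} {a b} → (∀ u v → adj H u v ≡ true → adj G u v ≡ true) → adj H a b ≡ false →
           ∀ u v → adj H u v ≡ true → adj (deleteEdge G a b) u v ≡ true
  H⊆G−ab {H} {a} {b} H⊆G ¬Hab u v h = deleteEdge-keeps G a b u v (H⊆G u v h) λ
    { (inj₁ (refl , refl)) → true≢false (trans (sym h) ¬Hab)
    ; (inj₂ (refl , refl)) → true≢false (trans (sym h) (trans (Graph.sym H b a) ¬Hab)) }

≅-sym : ∀ {n n'} {G : Graph n} {G' : Graph n'} → G ≅ G' → G' ≅ G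
≅-sym {G = G} {G'} i = record
  { to = from ; from = to ; from∘to = to∘from ; to∘from = from∘to
  ; preserve = λ u v → sym (trans (preserve (from u) (from v)) (cong₂ (adj G') (to∘from u) (to∘from v))) }
  where open _≅_ i

≅-adj : ∀ {n n'} {G : Graph n} {G' : Graph n'} (i : G ≅ G') →
        ∀ u v → adj G u v ≡ true → adj G' (_≅_.to i u) (_≅_.to i v) ≡ true
≅-adj i u v h = trans (sym (_≅_.preserve i u v)) h

≅-injective : ∀ {n n'} {G : Graph n} {G' : Graph n'} (i : G ≅ G') →
              ∀ {u v} → _≅_.to i u ≡ _≅_.to i v → u ≡ v
≅-injective i {u} {v} e = trans (sym (from∘to u)) (trans (cong from e) (from∘to v))
  where open _≅_ i

≅-IsDD2Graph : ∀ {n n'} {G : Graph n} {G' : Graph n'} → G ≅ G' → IsDD2Graph G → IsDD2Graph G'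
≅-IsDD2Graph {G = G} {G'} i = IsDD2Graph-transport G G' to from from∘to to∘from (≅-adj i)
  where open _≅_ i

≅-EdgeMinimal : ∀ {n n'} {G : Graph n} {G' : Graph n'} → G ≅ G' → EdgeMinimal G' → EdgeMinimal G
≅-EdgeMinimal {G = G} {G'} i (dd , critical) = ≅-IsDD2Graph (≅-sym i) dd , λ a b ab ddG−ab →
  critical (to a) (to b) (≅-adj i a b ab)
    (IsDD2Graph-transport (deleteEdge G a b) (deleteEdge G' (to a) (to b)) to from from∘to to∘from
      (λ u v h → deleteEdge-keeps G' (to a) (to b) (to u) (to v)
        (≅-adj i u v (deleteEdge-⊆ G a b u v h))
        λ { (inj₁ (p , q)) → deleteEdge-removes G a b u v h (inj₁ (≅-injective i p , ≅-injective i q))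
          ; (inj₂ (p , q)) → deleteEdge-removes G a b u v h (inj₂ (≅-injective i p , ≅-injective i q)) })
      ddG−ab)
  where open _≅_ i

OnlyNeighbours : ∀ {n} → Graph n → Fin n → (Fin n → Set) → Set
OnlyNeighbours {n} G v P = ∀ (z : Fin n) → adj G v z ≡ true → P z

module DD2Pair {n} (G : Graph n) (D D₂ : VSet n) (pair : IsDD2Pair G D D₂) where

  private
    disjoint = proj₁ pair
    dom      = proj₁ (proj₂ pair)
    dom₂     = proj₂ (proj₂ pair)

  D⇒∉D₂ : ∀ v → D v ≡ true → D₂ v ≡ false
  D⇒∉D₂ v v∈D = ¬-not (λ v∈D₂ → disjoint v (v∈D , v∈D₂))

  D-vertex-has-two-D₂-neighbours : ∀ v → D v ≡ true →
    ∃[ p ] ∃[ q ] (p ≢ q × D₂ p ≡ true × D₂ q ≡ true × adj G v p ≡ true × adj G v q ≡ true)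
  D-vertex-has-two-D₂-neighbours v v∈D = dom₂ v (D⇒∉D₂ v v∈D)

  pendant-neighbour∈D : ∀ v u → OnlyNeighbours G v (_≡ u) → D u ≡ true
  pendant-neighbour∈D v u pendant with D₂ v in v∈?D₂
  ... | false = let (p , q , p≢q , _ , _ , vp , vq) = dom₂ v v∈?D₂
                in ⊥-elim (p≢q (trans (pendant p vp) (sym (pendant q vq))))
  ... | true  = let (z , z∈D , vz) = dom v (¬-not λ v∈D → disjoint v (v∈D , v∈?D₂))
                in subst (λ w → D w ≡ true) (pendant z vz) z∈D

  no-isolated-vertex : ∀ v → (∀ z → adj G v z ≡ false) → ⊥
  no-isolated-vertex v isolated with D₂ v in v∈?D₂
  ... | false = let (p , _ , _ , _ , _ , vp , _) = dom₂ v v∈?D₂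
                in true≢false (trans (sym vp) (isolated p))
  ... | true  = let (z , _ , vz) = dom v (¬-not λ v∈D → disjoint v (v∈D , v∈?D₂))
                in true≢false (trans (sym vz) (isolated z))

-- Stars and C₄ are minimal

star-edgeMinimal : ∀ k → 2 ≤ k → EdgeMinimal (star k)
star-edgeMinimal (suc (suc k)) (s≤s (s≤s z≤n)) = (centre , leaves , disjoint , dom , dom₂) , critical
  where
  centre leaves : VSet (suc (suc (suc k)))
  centre zero    = true
  centre (suc _) = false
  leaves v = not (centre v)
  disjoint : Disjoint centre leaves
  disjoint = complement-disjointʳ centre
  dom : Dominating (star (suc (suc k))) centre
  dom (suc _) _ = zero , refl , refl
  dom₂ : TwoDominating (star (suc (suc k))) leaves
  dom₂ zero _ = suc zero , suc (suc zero) , (λ ()) , refl , refl , refl , refl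
  isolates : ∀ i a b → SameEdge a b (suc i) zero → ∀ z → adj (deleteEdge (star (suc (suc k))) a b) (suc i) z ≡ false
  isolates i a b _ (suc _) = refl
  isolates i a b e zero    = ¬-not λ h → deleteEdge-removes (star _) a b (suc i) zero h e
  critical : EdgeCritical (star (suc (suc k)))
  critical zero (suc i) _ (D , D₂ , pair) =
    DD2Pair.no-isolated-vertex (deleteEdge (star _) zero (suc i)) D D₂ pair (suc i) (isolates i zero (suc i) (inj₂ (refl , refl)))
  critical (suc i) zero _ (D , D₂ , pair) =
    DD2Pair.no-isolated-vertex (deleteEdge (star _) (suc i) zero) D D₂ pair (suc i) (isolates i (suc i) zero (inj₁ (refl , refl)))

onlyNeighbours? : ∀ {n} (G : Graph n) v {P : Fin n → Set} → (∀ z → Dec (P z)) → Dec (OnlyNeighbours G v P)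
onlyNeighbours? G v P? = all? λ z → (adj G v z Bool.≟ true) →-dec P? z

pendant-path-¬DD2 : ∀ {n} (G : Graph n) (p₀ p₁ p₂ p₃ : Fin n) →
  OnlyNeighbours G p₀ (_≡ p₁) → OnlyNeighbours G p₃ (_≡ p₂) →
  OnlyNeighbours G p₁ (λ z → z ≡ p₀ ⊎ z ≡ p₂) → ¬ IsDD2Graph G
pendant-path-¬DD2 G p₀ p₁ p₂ p₃ N₀ N₃ N₁ (D , D₂ , pair) =
  let (x , y , x≢y , x∈D₂ , y∈D₂ , p₁x , p₁y) = D-vertex-has-two-D₂-neighbours p₁ (pendant-neighbour∈D p₀ p₁ N₀)
  in x≢y (trans (≡p₀ x x∈D₂ (N₁ x p₁x)) (sym (≡p₀ y y∈D₂ (N₁ y p₁y))))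
  where
  open DD2Pair G D D₂ pair
  p₂∉D₂ : D₂ p₂ ≡ false
  p₂∉D₂ = D⇒∉D₂ p₂ (pendant-neighbour∈D p₃ p₂ N₃)
  ≡p₀ : ∀ x → D₂ x ≡ true → x ≡ p₀ ⊎ x ≡ p₂ → x ≡ p₀
  ≡p₀ x _    (inj₁ x≡p₀) = x≡p₀
  ≡p₀ x x∈D₂ (inj₂ refl) = ⊥-elim (true≢false (trans (sym x∈D₂) p₂∉D₂))

C₄-edgeMinimal : EdgeMinimal C4
C₄-edgeMinimal = (even , odd , complement-disjointʳ even , dom , dom₂) , critical
  where
  even odd : VSet 4
  even 0F = true
  even 1F = false
  even 2F = true
  even 3F = false
  odd v = not (even v)
  dom : Dominating C4 even
  dom 1F _ = 0F , refl , refl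
  dom 3F _ = 0F , refl , refl
  dom₂ : TwoDominating C4 odd
  dom₂ 0F _ = 1F , 3F , (λ ()) , refl , refl , refl , refl
  dom₂ 2F _ = 1F , 3F , (λ ()) , refl , refl , refl , refl
  dom₂ 3F ()
  -- The hypotheses of pendant-path-¬DD2 are decided by evaluation.
  path : ∀ a b p₀ p₁ p₂ p₃ →
    {_ : True (onlyNeighbours? (deleteEdge C4 a b) p₀ (_≟ p₁)
               ×-dec onlyNeighbours? (deleteEdge C4 a b) p₃ (_≟ p₂)
               ×-dec onlyNeighbours? (deleteEdge C4 a b) p₁ (λ z → (z ≟ p₀) ⊎-dec (z ≟ p₂)))} →
    ¬ IsDD2Graph (deleteEdge C4 a b)
  path a b p₀ p₁ p₂ p₃ {checked} =
    let (N₀ , N₃ , N₁) = toWitness checked in pendant-path-¬DD2 (deleteEdge C4 a b) p₀ p₁ p₂ p₃ N₀ N₃ N₁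
  critical : EdgeCritical C4
  critical 0F 1F _ = path 0F 1F 1F 2F 3F 0F
  critical 1F 0F _ = path 1F 0F 1F 2F 3F 0F
  critical 1F 2F _ = path 1F 2F 2F 3F 0F 1F
  critical 2F 1F _ = path 2F 1F 2F 3F 0F 1F
  critical 2F 3F _ = path 2F 3F 3F 0F 1F 2F
  critical 3F 2F _ = path 3F 2F 3F 0F 1F 2F
  critical 3F 0F _ = path 3F 0F 0F 1F 2F 3F
  critical 0F 3F _ = path 0F 3F 0F 1F 2F 3F
  critical 1F 3F ()
  critical 3F 3F ()

-- Subdivisions of corona multigraphs are minimal

isEnd-sound : ∀ H i e → isEnd H i e ≡ true → Incident H i e
isEnd-sound H i e h with ∨-true⇒ {⌊ proj₁ (ends H e) ≟ i ⌋} h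
... | inj₁ p = inj₁ (≟-true⇒≡ p)
... | inj₂ q = inj₂ (≟-true⇒≡ q)

isEnd-complete : ∀ H i e → Incident H i e → isEnd H i e ≡ true
isEnd-complete H i e (inj₁ p) rewrite ⌊⌋-yes (proj₁ (ends H e) ≟ i) p = refl
isEnd-complete H i e (inj₂ q) rewrite ⌊⌋-yes (proj₂ (ends H e) ≟ i) q = Bool.∨-zeroʳ _

Joins⇒Incidentʳ : ∀ H {e u v} → Joins H e u v → Incident H v e
Joins⇒Incidentʳ H (inj₁ (_ , q)) = inj₂ q
Joins⇒Incidentʳ H (inj₂ (p , _)) = inj₁ p

module Subdivision (H : Multigraph) where

  S : Graph (m H + k H)
  S = subdivision H

  vert : Fin (m H) → Fin (m H + k H)
  vert i = join (m H) (k H) (inj₁ i)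

  mid : Fin (k H) → Fin (m H + k H)
  mid e = join (m H) (k H) (inj₂ e)

  split-vert : ∀ i → splitAt (m H) (vert i) ≡ inj₁ i
  split-vert i = splitAt-join (m H) (k H) (inj₁ i)

  split-mid : ∀ e → splitAt (m H) (mid e) ≡ inj₂ e
  split-mid e = splitAt-join (m H) (k H) (inj₂ e)

  vert-or-mid : ∀ x → (∃[ i ] x ≡ vert i) ⊎ (∃[ e ] x ≡ mid e)
  vert-or-mid x with splitAt (m H) x in eq
  ... | inj₁ i = inj₁ (i , trans (sym (join-splitAt (m H) (k H) x)) (cong (join (m H) (k H)) eq))
  ... | inj₂ e = inj₂ (e , trans (sym (join-splitAt (m H) (k H) x)) (cong (join (m H) (k H)) eq))

  vert-injective : ∀ {i j} → vert i ≡ vert j → i ≡ j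
  vert-injective {i} {j} p = inj₁-injective (trans (sym (split-vert i)) (trans (cong (splitAt (m H)) p) (split-vert j)))

  adj-vert-mid : ∀ i e → adj S (vert i) (mid e) ≡ isEnd H i e
  adj-vert-mid i e rewrite split-vert i | split-mid e = refl

  adj-mid-vert : ∀ e i → adj S (mid e) (vert i) ≡ isEnd H i e
  adj-mid-vert e i rewrite split-vert i | split-mid e = refl

  adj-vert-vert : ∀ i j → adj S (vert i) (vert j) ≡ false
  adj-vert-vert i j rewrite split-vert i | split-vert j = refl

  adj-mid-mid : ∀ e f → adj S (mid e) (mid f) ≡ false
  adj-mid-mid e f rewrite split-mid e | split-mid f = refl

  neighbours-of-mid : ∀ e z → adj S (mid e) z ≡ true →
                      z ≡ vert (proj₁ (ends H e)) ⊎ z ≡ vert (proj₂ (ends H e))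
  neighbours-of-mid e z h with vert-or-mid z
  ... | inj₂ (f , refl) = ⊥-elim (true≢false (trans (sym h) (adj-mid-mid e f)))
  ... | inj₁ (i , refl) with isEnd-sound H i e (trans (sym (adj-mid-vert e i)) h)
  ... | inj₁ p = inj₁ (cong vert (sym p))
  ... | inj₂ q = inj₂ (cong vert (sym q))

  neighbours-of-vert : ∀ i z → adj S (vert i) z ≡ true → ∃[ e ] (z ≡ mid e × Incident H i e)
  neighbours-of-vert i z h with vert-or-mid z
  ... | inj₁ (j , refl) = ⊥-elim (true≢false (trans (sym h) (adj-vert-vert i j)))
  ... | inj₂ (e , refl) = e , refl , isEnd-sound H i e (trans (sym (adj-vert-mid i e)) h)

  neighbours-of-joining-mid : ∀ {f w u} → Joins H f w u → ∀ y → adj S (mid f) y ≡ true → y ≡ vert w ⊎ y ≡ vert u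
  neighbours-of-joining-mid {f} f-joins y h with f-joins | neighbours-of-mid f y h
  ... | inj₁ (p , _) | inj₁ r = inj₁ (trans r (cong vert p))
  ... | inj₁ (_ , q) | inj₂ r = inj₂ (trans r (cong vert q))
  ... | inj₂ (p , _) | inj₁ r = inj₂ (trans r (cong vert p))
  ... | inj₂ (_ , q) | inj₂ r = inj₁ (trans r (cong vert q))

  isDD2Graph : (∀ i → ∃[ e ] Incident H i e) → IsDD2Graph S
  isDD2Graph incident = isMid , (λ x → not (isMid x)) , complement-disjointʳ isMid , dom , dom₂
    where
    midSide : Fin (m H) ⊎ Fin (k H) → Bool
    midSide = [ (λ _ → false) , (λ _ → true) ]
    isMid : VSet (m H + k H)
    isMid x = midSide (splitAt (m H) x)
    dom : Dominating S isMid
    dom x x∉mid with vert-or-mid x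
    ... | inj₂ (e , refl) = ⊥-elim (true≢false (trans (sym (cong midSide (split-mid e))) x∉mid))
    ... | inj₁ (i , refl) = let (e , i∈e) = incident i in
      mid e , cong midSide (split-mid e) , trans (adj-vert-mid i e) (isEnd-complete H i e i∈e)
    dom₂ : TwoDominating S (λ x → not (isMid x))
    dom₂ x x∈mid with vert-or-mid x
    ... | inj₁ (i , refl) = ⊥-elim (true≢false (trans (sym (cong (λ s → not (midSide s)) (split-vert i))) x∈mid))
    ... | inj₂ (e , refl) = vert (proj₁ (ends H e)) , vert (proj₂ (ends H e)) ,
      (λ p → noLoop H e (vert-injective p)) ,
      cong (λ s → not (midSide s)) (split-vert _) , cong (λ s → not (midSide s)) (split-vert _) ,
      trans (adj-mid-vert e _) (isEnd-complete H _ e (inj₁ refl)) ,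
      trans (adj-mid-vert e _) (isEnd-complete H _ e (inj₂ refl))

  module SpanningSubgraph (G : Graph (m H + k H)) (G⊆S : ∀ u v → adj G u v ≡ true → adj S u v ≡ true)
                          (D D₂ : VSet (m H + k H)) (pair : IsDD2Pair G D D₂) where
    open DD2Pair G D D₂ pair

    D-vertex-not-leaf : ∀ w → D (vert w) ≡ true → ¬ MLeaf H w
    D-vertex-not-leaf w w∈D (g , _ , only-g) with D-vertex-has-two-D₂-neighbours (vert w) w∈D
    ... | x , y , x≢y , _ , _ , wx , wy with neighbours-of-vert w x (G⊆S _ _ wx) | neighbours-of-vert w y (G⊆S _ _ wy)
    ...   | e , refl , w∈e | f , refl , w∈f = x≢y (cong mid (trans (only-g e w∈e) (sym (only-g f w∈f))))

    -- The leaf u forces its midpoint into D, whose two D₂-neighbours would both have to be u.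
    D-vertex-not-next-to-leaf : ∀ w u f → Joins H f w u → MLeaf H u → D (vert w) ≡ true → ⊥
    D-vertex-not-next-to-leaf w u f f-joins (g , _ , only-g) w∈D =
      let (y₁ , y₂ , y₁≢y₂ , y₁∈D₂ , y₂∈D₂ , gy₁ , gy₂) = D-vertex-has-two-D₂-neighbours (mid f) mid-f∈D
      in y₁≢y₂ (trans (≡vert-u y₁ y₁∈D₂ gy₁) (sym (≡vert-u y₂ y₂∈D₂ gy₂)))
      where
      f≡g : f ≡ g
      f≡g = only-g f (Joins⇒Incidentʳ H f-joins)
      mid-f∈D : D (mid f) ≡ true
      mid-f∈D = pendant-neighbour∈D (vert u) (mid f) λ z h →
        let (e , z≡e , u∈e) = neighbours-of-vert u z (G⊆S _ _ h) in trans z≡e (cong mid (trans (only-g e u∈e) (sym f≡g)))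
      ≡vert-u : ∀ y → D₂ y ≡ true → adj G (mid f) y ≡ true → y ≡ vert u
      ≡vert-u y y∈D₂ h with neighbours-of-joining-mid f-joins y (G⊆S _ _ h)
      ... | inj₁ refl = ⊥-elim (true≢false (trans (sym y∈D₂) (D⇒∉D₂ (vert w) w∈D)))
      ... | inj₂ y≡u  = y≡u

    corona-vertex-not-in-D : IsCorona H → ∀ w → D (vert w) ≡ true → ⊥
    corona-vertex-not-in-D corona w w∈D with corona w
    ... | inj₁ w-leaf                        = D-vertex-not-leaf w w∈D w-leaf
    ... | inj₂ (u , (f , f-joins) , u-leaf) = D-vertex-not-next-to-leaf w u f f-joins u-leaf w∈D

  other-end : ∀ {i e} → Incident H i e → ∃[ w ] Joins H e i w
  other-end {e = e} (inj₁ p) = proj₂ (ends H e) , inj₁ (p , refl)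
  other-end {e = e} (inj₂ q) = proj₁ (ends H e) , inj₂ (refl , q)

  -- Deleting the edge from vert i to mid e leaves mid e pendant at vert w, w the other end of e.
  critical-at : IsCorona H → ∀ a b i e → Incident H i e → SameEdge a b (mid e) (vert i) →
                ¬ IsDD2Graph (deleteEdge S a b)
  critical-at corona a b i e i∈e removed (D , D₂ , pair) =
    SpanningSubgraph.corona-vertex-not-in-D (deleteEdge S a b) (deleteEdge-⊆ S a b) D D₂ pair corona w
      (DD2Pair.pendant-neighbour∈D (deleteEdge S a b) D D₂ pair (mid e) (vert w) pendant)
    where
    w = proj₁ (other-end i∈e)
    pendant : OnlyNeighbours (deleteEdge S a b) (mid e) (_≡ vert w)
    pendant z h with neighbours-of-joining-mid (proj₂ (other-end i∈e)) z (deleteEdge-⊆ S a b _ _ h)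
    ... | inj₁ refl = ⊥-elim (deleteEdge-removes S a b _ _ h removed)
    ... | inj₂ z≡w  = z≡w

  critical : IsCorona H → EdgeCritical S
  critical corona a b ab with vert-or-mid a | vert-or-mid b
  ... | inj₁ (i , refl) | inj₁ (j , refl) = ⊥-elim (true≢false (trans (sym ab) (adj-vert-vert i j)))
  ... | inj₂ (e , refl) | inj₂ (f , refl) = ⊥-elim (true≢false (trans (sym ab) (adj-mid-mid e f)))
  ... | inj₁ (i , refl) | inj₂ (e , refl) =
    critical-at corona a b i e (isEnd-sound H i e (trans (sym (adj-vert-mid i e)) ab)) (inj₂ (refl , refl))
  ... | inj₂ (e , refl) | inj₁ (i , refl) =
    critical-at corona a b i e (isEnd-sound H i e (trans (sym (adj-mid-vert e i)) ab)) (inj₁ (refl , refl))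

  edgeMinimal : IsCorona H → EdgeMinimal S
  edgeMinimal corona = isDD2Graph incident , critical corona
    where
    incident : ∀ i → ∃[ e ] Incident H i e
    incident i with corona i
    ... | inj₁ (e , i∈e , _)                  = e , i∈e
    ... | inj₂ (_ , (f , inj₁ (p , _)) , _) = f , inj₁ p
    ... | inj₂ (_ , (f , inj₂ (_ , q)) , _) = f , inj₂ q

module _ {n} (G : Graph n) where

  IsLeaf : Fin n → Set
  IsLeaf y = ∃[ x ] (adj G y x ≡ true × OnlyNeighbours G y (_≡ x))

  isLeaf? : ∀ y → Dec (IsLeaf y)
  isLeaf? y = any? λ x → (adj G y x Bool.≟ true) ×-dec onlyNeighbours? G y (_≟ x)

  leaf-or-second-neighbour : ∀ {v x} → adj G v x ≡ true → IsLeaf v ⊎ ∃[ x′ ] (adj G v x′ ≡ true × x′ ≢ x)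
  leaf-or-second-neighbour {v} {x} vx with onlyNeighbours? G v (_≟ x)
  ... | yes only-x = inj₁ (x , vx , only-x)
  ... | no ¬only-x with ¬∀⟶∃¬ n _ (λ z → (adj G v z Bool.≟ true) →-dec (z ≟ x)) ¬only-x
  ...   | x′ , ¬[vx′→x′≡x] with adj G v x′ in vx′
  ...     | true  = inj₂ (x′ , vx′ , λ x′≡x → ¬[vx′→x′≡x] (λ _ → x′≡x))
  ...     | false = ⊥-elim (¬[vx′→x′≡x] λ ())

  LeafAtDistanceTwo : Fin n → Set
  LeafAtDistanceTwo y = ∃[ x ] ∃[ u ] (adj G y x ≡ true × adj G x u ≡ true × u ≢ y × IsLeaf u)

  leafAtDistanceTwo? : ∀ y → Dec (LeafAtDistanceTwo y)
  leafAtDistanceTwo? y = any? λ x → any? λ u →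
    (adj G y x Bool.≟ true) ×-dec (adj G x u Bool.≟ true) ×-dec ¬? (u ≟ y) ×-dec isLeaf? u

  Branching : Fin n → Set
  Branching x = ∃[ a ] ∃[ b ] ∃[ c ] (a ≢ b × a ≢ c × b ≢ c
                × adj G x a ≡ true × adj G x b ≡ true × adj G x c ≡ true)

  branching? : ∀ x → Dec (Branching x)
  branching? x = any? λ a → any? λ b → any? λ c →
    ¬? (a ≟ b) ×-dec ¬? (a ≟ c) ×-dec ¬? (b ≟ c)
    ×-dec (adj G x a Bool.≟ true) ×-dec (adj G x b Bool.≟ true) ×-dec (adj G x c Bool.≟ true)

  ¬branching⇒two-neighbours : ∀ {x a b} → ¬ Branching x → adj G x a ≡ true → adj G x b ≡ true → a ≢ b →
                              OnlyNeighbours G x (λ z → z ≡ a ⊎ z ≡ b)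
  ¬branching⇒two-neighbours {x} {a} {b} ¬branching xa xb a≢b z xz with z ≟ a | z ≟ b
  ... | yes z≡a | _       = inj₁ z≡a
  ... | no  _   | yes z≡b = inj₂ z≡b
  ... | no  z≢a | no  z≢b = ⊥-elim (¬branching (a , b , z , a≢b , (λ p → z≢a (sym p)) , (λ p → z≢b (sym p)) , xa , xb , xz))

  branching-avoids : ∀ {x} → Branching x → ∀ y →
    ∃[ a ] ∃[ b ] (a ≢ b × adj G x a ≡ true × adj G x b ≡ true × a ≢ y × b ≢ y)
  branching-avoids (a , b , c , a≢b , a≢c , b≢c , xa , xb , xc) y with y ≟ a | y ≟ b
  ... | yes refl | _        = b , c , b≢c , xb , xc , (λ p → a≢b (sym p)) , (λ p → a≢c (sym p))
  ... | no  y≢a  | yes refl = a , c , a≢c , xa , xc , a≢b , (λ p → b≢c (sym p))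
  ... | no  y≢a  | no  y≢b  = a , b , a≢b , xa , xb , (λ p → y≢a (sym p)) , (λ p → y≢b (sym p))

  walk-preserves : (P : Fin n → Set) → (∀ v w → P v → adj G v w ≡ true → P w) →
                   ∀ {a b} → P a → Walk G a b → P b
  walk-preserves P step-P Pa here          = Pa
  walk-preserves P step-P Pa (step vw walk) = walk-preserves P step-P (step-P _ _ Pa vw) walk

three-distinct⇒3≤n : ∀ {n} (a b c : Fin n) → a ≢ b → a ≢ c → b ≢ c → 3 ≤ n
three-distinct⇒3≤n {suc (suc (suc n))} _ _ _ _ _ _ = s≤s (s≤s (s≤s z≤n))
three-distinct⇒3≤n {suc zero} zero zero _ a≢b _ _ = ⊥-elim (a≢b refl)
three-distinct⇒3≤n {suc (suc zero)} zero       zero       _          a≢b _   _   = ⊥-elim (a≢b refl)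
three-distinct⇒3≤n {suc (suc zero)} (suc zero) (suc zero) _          a≢b _   _   = ⊥-elim (a≢b refl)
three-distinct⇒3≤n {suc (suc zero)} zero       (suc zero) zero       _   a≢c _   = ⊥-elim (a≢c refl)
three-distinct⇒3≤n {suc (suc zero)} zero       (suc zero) (suc zero) _   _   b≢c = ⊥-elim (b≢c refl)
three-distinct⇒3≤n {suc (suc zero)} (suc zero) zero       zero       _   _   b≢c = ⊥-elim (b≢c refl)
three-distinct⇒3≤n {suc (suc zero)} (suc zero) zero       (suc zero) _   a≢c _   = ⊥-elim (a≢c refl)

≅star : ∀ {n} (G : Graph n) (x : Fin n) → Branching G x →
        (∀ v → v ≡ x ⊎ adj G x v ≡ true) → (∀ y → adj G x y ≡ true → OnlyNeighbours G y (_≡ x)) →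
        ∃[ k ] (2 ≤ k × G ≅ star k)
≅star {suc n} G x (a , b , c , a≢b , a≢c , b≢c , _) centre leaves =
  n , 2≤n (three-distinct⇒3≤n a b c a≢b a≢c b≢c) , record
    { to = to ; from = from
    ; from∘to = λ v → Perm.transpose-inverse zero x
    ; to∘from = λ v → Perm.transpose-inverse x zero
    ; preserve = λ u v → preserve u v (to u) (to v) refl refl }
  where
  2≤n : 3 ≤ suc n → 2 ≤ n
  2≤n (s≤s p) = p
  to from : Fin (suc n) → Fin (suc n)
  to   = Perm.transpose x zero
  from = Perm.transpose zero x
  to-x : to x ≡ zero
  to-x rewrite dec-true (x ≟ x) refl = refl
  to≡zero : ∀ v → to v ≡ zero → v ≡ x
  to≡zero v eq = trans (sym (Perm.transpose-inverse zero x {v})) (cong from eq)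
  to≡suc : ∀ v {j} → to v ≡ suc j → v ≢ x
  to≡suc v eq refl with trans (sym to-x) eq
  ... | ()
  x-adj : ∀ v → v ≢ x → adj G x v ≡ true
  x-adj v v≢x with centre v
  ... | inj₁ v≡x = ⊥-elim (v≢x v≡x)
  ... | inj₂ xv  = xv
  preserve : ∀ u v tu tv → to u ≡ tu → to v ≡ tv → adj G u v ≡ starAdj tu tv
  preserve u v zero    zero     eu ev rewrite to≡zero u eu | to≡zero v ev = irrefl G x
  preserve u v zero    (suc _)  eu ev rewrite to≡zero u eu = x-adj v (to≡suc v ev)
  preserve u v (suc _) zero     eu ev rewrite to≡zero v ev = trans (Graph.sym G u x) (x-adj u (to≡suc u eu))
  preserve u v (suc _) (suc _)  eu ev = ¬-not λ uv → to≡suc v ev (leaves u (x-adj u (to≡suc u eu)) v uv)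

≅-from-bijection : ∀ {n n'} (G : Graph n) (G' : Graph n') (from : Fin n' → Fin n) →
  (∀ v → ∃[ i ] from i ≡ v) → (∀ i j → from i ≡ from j → i ≡ j) →
  (∀ i j → adj G (from i) (from j) ≡ adj G' i j) → G ≅ G'
≅-from-bijection G G' from surjective injective preserve = record
  { to = λ v → proj₁ (surjective v) ; from = from
  ; from∘to = λ v → proj₂ (surjective v)
  ; to∘from = λ i → injective _ _ (proj₂ (surjective (from i)))
  ; preserve = λ u v → trans (cong₂ (adj G) (sym (proj₂ (surjective u))) (sym (proj₂ (surjective v))))
                             (preserve (proj₁ (surjective u)) (proj₁ (surjective v))) }

record Split {n} (p : Fin n → Bool) : Set where
  field
    #true #false  : ℕ
    split         : Fin n → Fin #true ⊎ Fin #false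
    unsplit       : Fin #true ⊎ Fin #false → Fin n
    unsplit∘split : ∀ v → unsplit (split v) ≡ v
    split∘unsplit : ∀ s → split (unsplit s) ≡ s
    unsplit-true  : ∀ i → p (unsplit (inj₁ i)) ≡ true
    unsplit-false : ∀ j → p (unsplit (inj₂ j)) ≡ false

Split-swap : ∀ {n} {p : Fin n → Bool} → Split p → Split (λ v → not (p v))
Split-swap P = record
  { #true = #false ; #false = #true
  ; split = λ v → swap (split v) ; unsplit = λ s → unsplit (swap s)
  ; unsplit∘split = λ v → trans (cong unsplit (swap-involutive (split v))) (unsplit∘split v)
  ; split∘unsplit = λ s → trans (cong swap (split∘unsplit (swap s))) (swap-involutive s)
  ; unsplit-true = λ j → cong not (unsplit-false j) ; unsplit-false = λ i → cong not (unsplit-true i) }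
  where open Split P

Split-resp : ∀ {n} {p q : Fin n → Bool} → (∀ v → p v ≡ q v) → Split p → Split q
Split-resp p≗q P = record
  { #true = #true ; #false = #false ; split = split ; unsplit = unsplit
  ; unsplit∘split = unsplit∘split ; split∘unsplit = split∘unsplit
  ; unsplit-true = λ i → trans (sym (p≗q _)) (unsplit-true i)
  ; unsplit-false = λ j → trans (sym (p≗q _)) (unsplit-false j) }
  where open Split P

Split-cons : ∀ {n} {p : Fin (suc n) → Bool} → p zero ≡ true → Split (λ v → p (suc v)) → Split p
Split-cons {n} {p} p0 P = record
  { #true = suc #true ; #false = #false ; split = split′ ; unsplit = unsplit′
  ; unsplit∘split = unsplit∘split′ ; split∘unsplit = split∘unsplit′
  ; unsplit-true = unsplit-true′ ; unsplit-false = unsplit-false }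
  where
  open Split P
  split′ : Fin (suc n) → Fin (suc #true) ⊎ Fin #false
  split′ zero    = inj₁ zero
  split′ (suc v) = map₁ suc (split v)
  unsplit′ : Fin (suc #true) ⊎ Fin #false → Fin (suc n)
  unsplit′ (inj₁ zero)    = zero
  unsplit′ (inj₁ (suc i)) = suc (unsplit (inj₁ i))
  unsplit′ (inj₂ j)       = suc (unsplit (inj₂ j))
  unsplit′-suc : ∀ s → unsplit′ (map₁ suc s) ≡ suc (unsplit s)
  unsplit′-suc (inj₁ _) = refl
  unsplit′-suc (inj₂ _) = refl
  unsplit∘split′ : ∀ v → unsplit′ (split′ v) ≡ v
  unsplit∘split′ zero    = refl
  unsplit∘split′ (suc v) = trans (unsplit′-suc (split v)) (cong suc (unsplit∘split v))
  split∘unsplit′ : ∀ s → split′ (unsplit′ s) ≡ s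
  split∘unsplit′ (inj₁ zero)    = refl
  split∘unsplit′ (inj₁ (suc i)) = cong (map₁ suc) (split∘unsplit (inj₁ i))
  split∘unsplit′ (inj₂ j)       = cong (map₁ suc) (split∘unsplit (inj₂ j))
  unsplit-true′ : ∀ i → p (unsplit′ (inj₁ i)) ≡ true
  unsplit-true′ zero    = p0
  unsplit-true′ (suc i) = unsplit-true i

splitBy : ∀ {n} (p : Fin n → Bool) → Split p
splitBy {zero} p = record
  { #true = 0 ; #false = 0 ; split = λ () ; unsplit = λ { (inj₁ ()) ; (inj₂ ()) }
  ; unsplit∘split = λ () ; split∘unsplit = λ { (inj₁ ()) ; (inj₂ ()) }
  ; unsplit-true = λ () ; unsplit-false = λ () }
splitBy {suc n} p with p zero in p0
... | true  = Split-cons p0 (splitBy (λ v → p (suc v)))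
... | false = Split-resp (λ v → Bool.not-involutive (p v))
                (Split-swap (Split-cons (cong not p0) (Split-swap (splitBy (λ v → p (suc v))))))

-- Structure of an edge-critical connected DD₂-graph

StarC₄OrCoronaSubdivision : ∀ {n} → Graph n → Set
StarC₄OrCoronaSubdivision G =
  (∃[ k ] (2 ≤ k × G ≅ star k)) ⊎ (G ≅ C4) ⊎ (∃[ H ] (MConnected H × IsCorona H × G ≅ subdivision H))

module Critical {n} (G : Graph n) (critical : EdgeCritical G)
                (D D₂ : VSet n) (pair : IsDD2Pair G D D₂) where

  open DD2Pair G D D₂ pair
  private
    dom  = proj₁ (proj₂ pair)
    dom₂ = proj₂ (proj₂ pair)

  D₂ᶜ : VSet n
  D₂ᶜ v = not (D₂ v)

  adj-sym : ∀ {u v} → adj G u v ≡ true → adj G v u ≡ true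
  adj-sym {u} {v} uv = trans (Graph.sym G v u) uv

  D₂-separates : ∀ {u v} → D₂ u ≡ true → D₂ v ≡ false → u ≢ v
  D₂-separates u∈D₂ v∉D₂ refl = true≢false (trans (sym u∈D₂) v∉D₂)

  D₂-vertex-has-D₂ᶜ-neighbour : ∀ v → D₂ v ≡ true → ∃[ u ] (D₂ u ≡ false × adj G v u ≡ true)
  D₂-vertex-has-D₂ᶜ-neighbour v v∈D₂ =
    let (u , u∈D , vu) = dom v (¬-not λ v∈D → proj₁ pair v (v∈D , v∈D₂)) in u , D⇒∉D₂ u u∈D , vu

  another-D₂-neighbour : ∀ x → D₂ x ≡ false → ∀ s → ∃[ z ] (adj G x z ≡ true × D₂ z ≡ true × z ≢ s)
  another-D₂-neighbour x x∉D₂ s with dom₂ x x∉D₂ | s ≟ proj₁ (dom₂ x x∉D₂)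
  ... | p , q , p≢q , _ , q∈D₂ , _ , xq | yes refl = q , xq , q∈D₂ , λ q≡p → p≢q (sym q≡p)
  ... | p , _ , _ , p∈D₂ , _ , xp , _   | no s≢p   = p , xp , p∈D₂ , λ p≡s → s≢p (sym p≡s)

  -- Otherwise (D₂ᶜ, D₂) is a DD₂-pair of G − uv: no witness of it uses an edge inside a side.
  edge-crosses-D₂ : ∀ u v → adj G u v ≡ true → D₂ u ≢ D₂ v
  edge-crosses-D₂ u v uv same = critical u v uv (D₂ᶜ , D₂ , complement-disjointˡ D₂ , dom′ , dom₂′)
    where
    keep : ∀ {s t} → D₂ s ≢ D₂ t → adj G s t ≡ true → adj (deleteEdge G u v) s t ≡ true
    keep {s} {t} = deleteEdge-keeps-separated G u v D₂ same s t
    dom′ : Dominating (deleteEdge G u v) D₂ᶜ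
    dom′ t t∈D₂ with D₂-vertex-has-D₂ᶜ-neighbour t (not-injective t∈D₂)
    ... | t′ , t′∉D₂ , tt′ = t′ , cong not t′∉D₂ , keep (λ p → true≢false (trans (sym (not-injective t∈D₂)) (trans p t′∉D₂))) tt′
    dom₂′ : TwoDominating (deleteEdge G u v) D₂
    dom₂′ t t∉D₂ with dom₂ t t∉D₂
    ... | p , q , p≢q , p∈D₂ , q∈D₂ , tp , tq =
      p , q , p≢q , p∈D₂ , q∈D₂ , keep (λ e → true≢false (trans (sym p∈D₂) (trans (sym e) t∉D₂))) tp
                                , keep (λ e → true≢false (trans (sym q∈D₂) (trans (sym e) t∉D₂))) tq

  neighbour-of-D₂ : ∀ {u v} → adj G u v ≡ true → D₂ u ≡ true → D₂ v ≡ false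
  neighbour-of-D₂ {u} {v} uv u∈D₂ = ¬-not λ v∈D₂ → edge-crosses-D₂ u v uv (trans u∈D₂ (sym v∈D₂))

  neighbour-of-D₂ᶜ : ∀ {u v} → adj G u v ≡ true → D₂ u ≡ false → D₂ v ≡ true
  neighbour-of-D₂ᶜ {u} {v} uv u∉D₂ = ¬-not λ v∉D₂ → edge-crosses-D₂ u v uv (trans u∉D₂ (sym v∉D₂))

  same-side-non-adjacent : ∀ u v → D₂ u ≡ D₂ v → adj G u v ≡ false
  same-side-non-adjacent u v same = ¬-not λ uv → edge-crosses-D₂ u v uv same

  -- G − xy keeps the pair (D₂ᶜ, D₂) if y has a second neighbour z: x still has two D₂-neighbours besides y.
  branching-centre : ∀ x → D₂ x ≡ false → Branching G x →
                     ∀ y → adj G x y ≡ true → OnlyNeighbours G y (_≡ x)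
  branching-centre x x∉D₂ branching y xy z yz with z ≟ x
  ... | yes z≡x = z≡x
  ... | no  z≢x = ⊥-elim (critical x y xy (D₂ᶜ , D₂ , complement-disjointˡ D₂ , dom′ , dom₂′))
    where
    y∈D₂ : D₂ y ≡ true
    y∈D₂ = neighbour-of-D₂ᶜ xy x∉D₂
    y≢x : y ≢ x
    y≢x = D₂-separates y∈D₂ x∉D₂
    dom′ : Dominating (deleteEdge G x y) D₂ᶜ
    dom′ t t∈D₂ = dom-at t t∈D₂ (t ≟ y)
      where
      dom-at : ∀ t → D₂ᶜ t ≡ false → Dec (t ≡ y) → ∃[ u ] (D₂ᶜ u ≡ true × adj (deleteEdge G x y) t u ≡ true)
      dom-at t _ (yes refl) = z , cong not (neighbour-of-D₂ yz y∈D₂) ,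
        deleteEdge-keeps′ G x y y z yz (λ p → y≢x (proj₁ p)) (λ p → z≢x (proj₂ p))
      dom-at t t∈D₂ (no t≢y) with D₂-vertex-has-D₂ᶜ-neighbour t (not-injective t∈D₂)
      ... | t′ , t′∉D₂ , tt′ = t′ , cong not t′∉D₂ ,
        deleteEdge-keeps′ G x y t t′ tt′ (λ p → D₂-separates (not-injective t∈D₂) x∉D₂ (proj₁ p)) (λ p → t≢y (proj₁ p))
    dom₂′ : TwoDominating (deleteEdge G x y) D₂
    dom₂′ t t∉D₂ = dom₂-at t t∉D₂ (t ≟ x)
      where
      dom₂-at : ∀ t → D₂ t ≡ false → Dec (t ≡ x) → ∃[ p ] ∃[ q ] (p ≢ q × D₂ p ≡ true × D₂ q ≡ true
                  × adj (deleteEdge G x y) t p ≡ true × adj (deleteEdge G x y) t q ≡ true)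
      dom₂-at t _ (yes refl) with branching-avoids G branching y
      ... | a , b , a≢b , xa , xb , a≢y , b≢y =
        a , b , a≢b , neighbour-of-D₂ᶜ xa x∉D₂ , neighbour-of-D₂ᶜ xb x∉D₂ ,
        deleteEdge-keeps′ G x y x a xa (λ p → a≢y (proj₂ p)) (λ p → y≢x (sym (proj₁ p))) ,
        deleteEdge-keeps′ G x y x b xb (λ p → b≢y (proj₂ p)) (λ p → y≢x (sym (proj₁ p)))
      dom₂-at t t∉D₂ (no t≢x) with dom₂ t t∉D₂
      ... | p , q , p≢q , p∈D₂ , q∈D₂ , tp , tq =
        p , q , p≢q , p∈D₂ , q∈D₂ ,
        deleteEdge-keeps′ G x y t p tp (λ r → t≢x (proj₁ r)) (λ r → D₂-separates y∈D₂ t∉D₂ (sym (proj₁ r))) ,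
        deleteEdge-keeps′ G x y t q tq (λ r → t≢x (proj₁ r)) (λ r → D₂-separates y∈D₂ t∉D₂ (sym (proj₁ r)))

  branching⇒star : Connected G → ∀ x → D₂ x ≡ false → Branching G x → ∃[ k ] (2 ≤ k × G ≅ star k)
  branching⇒star (_ , walk) x x∉D₂ branching = ≅star G x branching centre leaves
    where
    leaves : ∀ y → adj G x y ≡ true → OnlyNeighbours G y (_≡ x)
    leaves = branching-centre x x∉D₂ branching
    centre : ∀ v → v ≡ x ⊎ adj G x v ≡ true
    centre v = walk-preserves G (λ v → v ≡ x ⊎ adj G x v ≡ true) closed (inj₁ refl) (walk x v)
      where
      closed : ∀ v w → v ≡ x ⊎ adj G x v ≡ true → adj G v w ≡ true → w ≡ x ⊎ adj G x w ≡ true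
      closed v w (inj₁ refl) vw = inj₂ vw
      closed v w (inj₂ xv)   vw = inj₁ (leaves v xv w vw)

  Covered : Fin n → Fin n → Set
  Covered w s = OnlyNeighbours G w (λ t → adj G t s ≡ true)

  SeparatedFrom : Fin n → Fin n → Set
  SeparatedFrom s w = D₂ w ≡ true → w ≢ s → ∃[ t ] (adj G w t ≡ true × adj G t s ≡ false)

  separatedFrom? : ∀ s w → Dec (SeparatedFrom s w)
  separatedFrom? s w = (D₂ w Bool.≟ true) →-dec ¬? (w ≟ s) →-dec
                       any? λ t → (adj G w t Bool.≟ true) ×-dec (adj G t s Bool.≟ false)

  Separated : Fin n → Set
  Separated s = ∀ w → SeparatedFrom s w

  -- Take s out of D₂ and put its neighbours in: the edge from x₁ to its other D₂-neighbour z becomes superfluous.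
  module Recolour (s : Fin n) (s∈D₂ : D₂ s ≡ true) {x₁ x₂ : Fin n} (sx₁ : adj G s x₁ ≡ true)
                  (sx₂ : adj G s x₂ ≡ true) (x₁≢x₂ : x₁ ≢ x₂) (separated : Separated s) where

    D₂′ : VSet n
    D₂′ v = if D₂ v then not ⌊ v ≟ s ⌋ else adj G v s

    D₂′-keeps : ∀ {v} → D₂ v ≡ true → v ≢ s → D₂′ v ≡ true
    D₂′-keeps {v} v∈D₂ v≢s rewrite v∈D₂ | ⌊⌋-no (v ≟ s) v≢s = refl

    D₂′-gains : ∀ {v} → D₂ v ≡ false → adj G v s ≡ true → D₂′ v ≡ true
    D₂′-gains v∉D₂ vs rewrite v∉D₂ = vs

    D₂′-omits : ∀ {v} → D₂ v ≡ false → adj G v s ≡ false → D₂′ v ≡ false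
    D₂′-omits v∉D₂ ¬vs rewrite v∉D₂ = ¬vs

    D₂′-members : ∀ v → D₂′ v ≡ true → (D₂ v ≡ true × v ≢ s) ⊎ (D₂ v ≡ false × adj G v s ≡ true)
    D₂′-members v h with D₂ v | v ≟ s
    ... | true  | yes _   = ⊥-elim (true≢false (sym h))
    ... | true  | no  v≢s = inj₁ (refl , v≢s)
    ... | false | _       = inj₂ (refl , h)

    D₂′-non-members : ∀ v → D₂′ v ≡ false → (v ≡ s) ⊎ (D₂ v ≡ false × adj G v s ≡ false)
    D₂′-non-members v h with D₂ v | v ≟ s
    ... | true  | yes v≡s = inj₁ v≡s
    ... | true  | no  _   = ⊥-elim (true≢false h)
    ... | false | _       = inj₂ (refl , h)

    x₁∉D₂ : D₂ x₁ ≡ false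
    x₁∉D₂ = neighbour-of-D₂ sx₁ s∈D₂

    z : Fin n
    z = proj₁ (another-D₂-neighbour x₁ x₁∉D₂ s)

    x₁z : adj G x₁ z ≡ true
    x₁z = proj₁ (proj₂ (another-D₂-neighbour x₁ x₁∉D₂ s))

    z∈D₂ : D₂ z ≡ true
    z∈D₂ = proj₁ (proj₂ (proj₂ (another-D₂-neighbour x₁ x₁∉D₂ s)))

    z≢s : z ≢ s
    z≢s = proj₂ (proj₂ (proj₂ (another-D₂-neighbour x₁ x₁∉D₂ s)))

    not-next-to-s : ∀ {v} → adj G v s ≡ false → v ≢ x₁
    not-next-to-s ¬vs refl = true≢false (trans (sym (adj-sym sx₁)) ¬vs)

    dominating : Dominating (deleteEdge G z x₁) (λ v → not (D₂′ v))
    dominating v v∈D₂′ with D₂′-members v (not-injective v∈D₂′)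
    ... | inj₁ (v∈D₂ , v≢s) =
      let (t , vt , ¬ts) = separated v v∈D₂ v≢s in
      t , cong not (D₂′-omits (neighbour-of-D₂ vt v∈D₂) ¬ts) ,
      deleteEdge-keeps′ G z x₁ v t vt (λ p → not-next-to-s ¬ts (proj₂ p))
                                      (λ p → D₂-separates v∈D₂ x₁∉D₂ (proj₁ p))
    ... | inj₂ (v∉D₂ , vs) = s , cong not (D₂′-non-member-s) ,
      deleteEdge-keeps′ G z x₁ v s vs (λ p → D₂-separates s∈D₂ x₁∉D₂ (proj₂ p)) (λ p → z≢s (sym (proj₂ p)))
      where
      D₂′-non-member-s : D₂′ s ≡ false
      D₂′-non-member-s rewrite s∈D₂ | ⌊⌋-yes (s ≟ s) refl = refl

    two-dominating : TwoDominating (deleteEdge G z x₁) D₂′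
    two-dominating v v∉D₂′ with D₂′-non-members v v∉D₂′
    ... | inj₁ refl =
      x₁ , x₂ , x₁≢x₂ , D₂′-gains x₁∉D₂ (adj-sym sx₁) , D₂′-gains (neighbour-of-D₂ sx₂ s∈D₂) (adj-sym sx₂) ,
      deleteEdge-keeps′ G z x₁ s x₁ sx₁ (λ p → z≢s (sym (proj₁ p))) (λ p → D₂-separates s∈D₂ x₁∉D₂ (proj₁ p)) ,
      deleteEdge-keeps′ G z x₁ s x₂ sx₂ (λ p → z≢s (sym (proj₁ p))) (λ p → D₂-separates s∈D₂ x₁∉D₂ (proj₁ p))
    ... | inj₂ (v∉D₂ , ¬vs) =
      let (p , q , p≢q , p∈D₂ , q∈D₂ , vp , vq) = dom₂ v v∉D₂ in
      p , q , p≢q , D₂′-keeps p∈D₂ (λ { refl → true≢false (trans (sym vp) ¬vs) }) ,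
                    D₂′-keeps q∈D₂ (λ { refl → true≢false (trans (sym vq) ¬vs) }) ,
      deleteEdge-keeps′ G z x₁ v p vp (λ r → D₂-separates z∈D₂ v∉D₂ (sym (proj₁ r))) (λ r → not-next-to-s ¬vs (proj₁ r)) ,
      deleteEdge-keeps′ G z x₁ v q vq (λ r → D₂-separates z∈D₂ v∉D₂ (sym (proj₁ r))) (λ r → not-next-to-s ¬vs (proj₁ r))

    absurd : ⊥
    absurd = critical z x₁ (adj-sym x₁z)
      ((λ v → not (D₂′ v)) , D₂′ , complement-disjointˡ D₂′ , dominating , two-dominating)

  covered-by-another : ∀ s → D₂ s ≡ true → ∀ {x₁ x₂} → adj G s x₁ ≡ true → adj G s x₂ ≡ true → x₁ ≢ x₂ →
                       ∃[ w ] (D₂ w ≡ true × w ≢ s × Covered w s)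
  covered-by-another s s∈D₂ sx₁ sx₂ x₁≢x₂ with all? (separatedFrom? s)
  ... | yes separated = ⊥-elim (Recolour.absurd s s∈D₂ sx₁ sx₂ x₁≢x₂ separated)
  ... | no ¬separated with ¬∀⟶∃¬ n (SeparatedFrom s) (separatedFrom? s) ¬separated
  ...   | w , ¬separated-w with D₂ w in w∈?D₂ | w ≟ s
  ...     | false | _        = ⊥-elim (¬separated-w λ ())
  ...     | true  | yes w≡s  = ⊥-elim (¬separated-w λ _ w≢s → ⊥-elim (w≢s w≡s))
  ...     | true  | no  w≢s  = w , w∈?D₂ , w≢s , λ t wt →
    ¬-not λ ¬ts → ¬separated-w λ _ _ → t , wt , ¬ts

  module TwoNeighbours (connected : Connected G) (¬branching : ∀ x → D₂ x ≡ false → ¬ Branching G x) where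

    module Twins {y w x₁ x₂ : Fin n} (y∈D₂ : D₂ y ≡ true) (w∈D₂ : D₂ w ≡ true) (y≢w : y ≢ w)
                 (y⊆w : Covered y w) (w⊆y : Covered w y)
                 (yx₁ : adj G y x₁ ≡ true) (yx₂ : adj G y x₂ ≡ true) (x₁≢x₂ : x₁ ≢ x₂) where

      x₁∉D₂ : D₂ x₁ ≡ false
      x₁∉D₂ = neighbour-of-D₂ yx₁ y∈D₂

      x₂∉D₂ : D₂ x₂ ≡ false
      x₂∉D₂ = neighbour-of-D₂ yx₂ y∈D₂

      spanned : ∀ v → v ≡ y ⊎ v ≡ w ⊎ adj G y v ≡ true
      spanned v = walk-preserves G (λ v → v ≡ y ⊎ v ≡ w ⊎ adj G y v ≡ true) closed (inj₁ refl) (proj₂ connected y v)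
        where
        closed : ∀ v u → v ≡ y ⊎ v ≡ w ⊎ adj G y v ≡ true → adj G v u ≡ true → u ≡ y ⊎ u ≡ w ⊎ adj G y u ≡ true
        closed v u (inj₁ refl)        vu = inj₂ (inj₂ vu)
        closed v u (inj₂ (inj₁ refl)) vu = inj₂ (inj₂ (adj-sym (w⊆y u vu)))
        closed v u (inj₂ (inj₂ yv))   vu with ¬branching⇒two-neighbours G (¬branching v (neighbour-of-D₂ yv y∈D₂))
                                                (adj-sym yv) (y⊆w v yv) y≢w u vu
        ... | inj₁ u≡y = inj₁ u≡y
        ... | inj₂ u≡w = inj₂ (inj₁ u≡w)

      -- With a third neighbour x₃ of y, the edge y x₁ is superfluous for (D₂, D₂ᶜ).
      no-third-neighbour : ∀ {x₃} → adj G y x₃ ≡ true → x₃ ≢ x₁ → x₃ ≢ x₂ → ⊥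
      no-third-neighbour {x₃} yx₃ x₃≢x₁ x₃≢x₂ =
        critical y x₁ yx₁ (D₂ , D₂ᶜ , complement-disjointʳ D₂ , dominating , two-dominating)
        where
        dominating : Dominating (deleteEdge G y x₁) D₂
        dominating v v∉D₂ with spanned v
        ... | inj₁ refl        = ⊥-elim (true≢false (trans (sym y∈D₂) v∉D₂))
        ... | inj₂ (inj₁ refl) = ⊥-elim (true≢false (trans (sym w∈D₂) v∉D₂))
        ... | inj₂ (inj₂ yv)   = w , w∈D₂ ,
          deleteEdge-keeps′ G y x₁ v w (y⊆w v yv) (λ p → D₂-separates y∈D₂ v∉D₂ (sym (proj₁ p))) (λ p → y≢w (sym (proj₂ p)))
        two-dominating : TwoDominating (deleteEdge G y x₁) D₂ᶜ
        two-dominating v v∈D₂ with spanned v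
        ... | inj₁ refl =
          x₂ , x₃ , (λ p → x₃≢x₂ (sym p)) , cong not x₂∉D₂ , cong not (neighbour-of-D₂ yx₃ y∈D₂) ,
          deleteEdge-keeps′ G y x₁ y x₂ yx₂ (λ p → x₁≢x₂ (sym (proj₂ p))) (λ p → D₂-separates y∈D₂ x₁∉D₂ (proj₁ p)) ,
          deleteEdge-keeps′ G y x₁ y x₃ yx₃ (λ p → x₃≢x₁ (proj₂ p)) (λ p → D₂-separates y∈D₂ x₁∉D₂ (proj₁ p))
        ... | inj₂ (inj₁ refl) =
          x₁ , x₂ , x₁≢x₂ , cong not x₁∉D₂ , cong not x₂∉D₂ ,
          deleteEdge-keeps′ G y x₁ w x₁ (adj-sym (y⊆w x₁ yx₁)) (λ p → y≢w (sym (proj₁ p))) (λ p → D₂-separates w∈D₂ x₁∉D₂ (proj₁ p)) ,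
          deleteEdge-keeps′ G y x₁ w x₂ (adj-sym (y⊆w x₂ yx₂)) (λ p → y≢w (sym (proj₁ p))) (λ p → D₂-separates w∈D₂ x₁∉D₂ (proj₁ p))
        ... | inj₂ (inj₂ yv) = ⊥-elim (true≢false (trans (sym (not-injective v∈D₂)) (neighbour-of-D₂ yv y∈D₂)))

      cycle : Fin 4 → Fin n
      cycle 0F = y
      cycle 1F = x₁
      cycle 2F = w
      cycle 3F = x₂

      cycle-surjective : ∀ v → ∃[ i ] cycle i ≡ v
      cycle-surjective v with spanned v
      ... | inj₁ refl        = 0F , refl
      ... | inj₂ (inj₁ refl) = 2F , refl
      ... | inj₂ (inj₂ yv) with v ≟ x₁ | v ≟ x₂
      ...   | yes v≡x₁ | _        = 1F , sym v≡x₁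
      ...   | no  _    | yes v≡x₂ = 3F , sym v≡x₂
      ...   | no  v≢x₁ | no  v≢x₂ = ⊥-elim (no-third-neighbour yv v≢x₁ v≢x₂)

      cycle-injective : ∀ i j → cycle i ≡ cycle j → i ≡ j
      cycle-injective 0F 0F _ = refl
      cycle-injective 1F 1F _ = refl
      cycle-injective 2F 2F _ = refl
      cycle-injective 3F 3F _ = refl
      cycle-injective 0F 1F p = ⊥-elim (D₂-separates y∈D₂ x₁∉D₂ p)
      cycle-injective 0F 2F p = ⊥-elim (y≢w p)
      cycle-injective 0F 3F p = ⊥-elim (D₂-separates y∈D₂ x₂∉D₂ p)
      cycle-injective 1F 0F p = ⊥-elim (D₂-separates y∈D₂ x₁∉D₂ (sym p))
      cycle-injective 1F 2F p = ⊥-elim (D₂-separates w∈D₂ x₁∉D₂ (sym p))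
      cycle-injective 1F 3F p = ⊥-elim (x₁≢x₂ p)
      cycle-injective 2F 0F p = ⊥-elim (y≢w (sym p))
      cycle-injective 2F 1F p = ⊥-elim (D₂-separates w∈D₂ x₁∉D₂ p)
      cycle-injective 2F 3F p = ⊥-elim (D₂-separates w∈D₂ x₂∉D₂ p)
      cycle-injective 3F 0F p = ⊥-elim (D₂-separates y∈D₂ x₂∉D₂ (sym p))
      cycle-injective 3F 1F p = ⊥-elim (x₁≢x₂ (sym p))
      cycle-injective 3F 2F p = ⊥-elim (D₂-separates w∈D₂ x₂∉D₂ (sym p))

      cycle-preserves : ∀ i j → adj G (cycle i) (cycle j) ≡ c4Adj i j
      cycle-preserves 0F 0F = irrefl G y
      cycle-preserves 0F 1F = yx₁
      cycle-preserves 0F 2F = same-side-non-adjacent y w (trans y∈D₂ (sym w∈D₂))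
      cycle-preserves 0F 3F = yx₂
      cycle-preserves 1F 0F = adj-sym yx₁
      cycle-preserves 1F 1F = irrefl G x₁
      cycle-preserves 1F 2F = y⊆w x₁ yx₁
      cycle-preserves 1F 3F = same-side-non-adjacent x₁ x₂ (trans x₁∉D₂ (sym x₂∉D₂))
      cycle-preserves 2F 0F = same-side-non-adjacent w y (trans w∈D₂ (sym y∈D₂))
      cycle-preserves 2F 1F = adj-sym (y⊆w x₁ yx₁)
      cycle-preserves 2F 2F = irrefl G w
      cycle-preserves 2F 3F = adj-sym (y⊆w x₂ yx₂)
      cycle-preserves 3F 0F = adj-sym yx₂
      cycle-preserves 3F 1F = same-side-non-adjacent x₂ x₁ (trans x₂∉D₂ (sym x₁∉D₂))
      cycle-preserves 3F 2F = y⊆w x₂ yx₂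
      cycle-preserves 3F 3F = irrefl G x₂

      ≅C₄ : G ≅ C4
      ≅C₄ = ≅-from-bijection G C4 cycle cycle-surjective cycle-injective cycle-preserves

    -- y ∈ D₂ is covered by some w, which is covered in turn by some w′; w′ = y unless a common
    -- neighbour of w′, w and y branches.
    non-corona⇒C₄ : ∀ y → D₂ y ≡ true → ¬ (IsLeaf G y ⊎ LeafAtDistanceTwo G y) → G ≅ C4
    non-corona⇒C₄ y y∈D₂ ¬corona with D₂-vertex-has-D₂ᶜ-neighbour y y∈D₂
    ... | x₁ , _ , yx₁ with leaf-or-second-neighbour G yx₁
    ... | inj₁ y-leaf = ⊥-elim (¬corona (inj₁ y-leaf))
    ... | inj₂ (x₂ , yx₂ , x₂≢x₁) with covered-by-another y y∈D₂ yx₁ yx₂ (λ p → x₂≢x₁ (sym p))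
    ... | w , w∈D₂ , w≢y , w⊆y with D₂-vertex-has-D₂ᶜ-neighbour w w∈D₂
    ... | t , _ , wt with leaf-or-second-neighbour G wt
    ... | inj₁ w-leaf = ⊥-elim (¬corona (inj₂ (t , w , adj-sym (w⊆y t wt) , adj-sym wt , w≢y , w-leaf)))
    ... | inj₂ (t′ , wt′ , t′≢t) with covered-by-another w w∈D₂ wt wt′ (λ p → t′≢t (sym p))
    ... | w′ , w′∈D₂ , w′≢w , w′⊆w with w′ ≟ y
    ... | yes refl = Twins.≅C₄ y∈D₂ w∈D₂ (λ p → w≢y (sym p)) w′⊆w w⊆y yx₁ yx₂ (λ p → x₂≢x₁ (sym p))
    ... | no  w′≢y with D₂-vertex-has-D₂ᶜ-neighbour w′ w′∈D₂
    ... | u , u∉D₂ , w′u = ⊥-elim (¬branching u u∉D₂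
      (w′ , w , y , w′≢w , w′≢y , w≢y , adj-sym w′u , uw , w⊆y u (adj-sym uw)))
      where
      uw : adj G u w ≡ true
      uw = w′⊆w u w′u

    module _ (x : Fin n) (x∉D₂ : D₂ x ≡ false) where
      nb₁ nb₂ : Fin n
      nb₁ = proj₁ (dom₂ x x∉D₂)
      nb₂ = proj₁ (proj₂ (dom₂ x x∉D₂))

      nb₁≢nb₂ : nb₁ ≢ nb₂
      nb₁≢nb₂ = let (_ , _ , p≢q , _) = dom₂ x x∉D₂ in p≢q

      nb₁∈D₂ : D₂ nb₁ ≡ true
      nb₁∈D₂ = let (_ , _ , _ , p∈D₂ , _) = dom₂ x x∉D₂ in p∈D₂

      nb₂∈D₂ : D₂ nb₂ ≡ true
      nb₂∈D₂ = let (_ , _ , _ , _ , q∈D₂ , _) = dom₂ x x∉D₂ in q∈D₂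

      adj-nb₁ : adj G x nb₁ ≡ true
      adj-nb₁ = let (_ , _ , _ , _ , _ , xp , _) = dom₂ x x∉D₂ in xp

      adj-nb₂ : adj G x nb₂ ≡ true
      adj-nb₂ = let (_ , _ , _ , _ , _ , _ , xq) = dom₂ x x∉D₂ in xq

      only-nb₁-nb₂ : OnlyNeighbours G x (λ z → z ≡ nb₁ ⊎ z ≡ nb₂)
      only-nb₁-nb₂ = ¬branching⇒two-neighbours G (¬branching x x∉D₂) adj-nb₁ adj-nb₂ nb₁≢nb₂

    -- H has the vertices of D₂; each vertex outside D₂ is an edge joining its two neighbours.
    module Corona (corona : ∀ y → D₂ y ≡ true → IsLeaf G y ⊎ LeafAtDistanceTwo G y) where
      open Split (splitBy D₂)

      vertex : Fin #true → Fin n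
      vertex i = unsplit (inj₁ i)

      midpoint : Fin #false → Fin n
      midpoint j = unsplit (inj₂ j)

      vertex-index : ∀ v → D₂ v ≡ true → ∃[ i ] vertex i ≡ v
      vertex-index v v∈D₂ with split v in eq
      ... | inj₁ i = i , trans (cong unsplit (sym eq)) (unsplit∘split v)
      ... | inj₂ j = ⊥-elim (true≢false (trans (sym v∈D₂)
                       (trans (cong D₂ (trans (sym (unsplit∘split v)) (cong unsplit eq))) (unsplit-false j))))

      vertexOf : ∀ v → D₂ v ≡ true → Fin #true
      vertexOf v v∈D₂ = proj₁ (vertex-index v v∈D₂)

      vertex-vertexOf : ∀ v v∈D₂ → vertex (vertexOf v v∈D₂) ≡ v
      vertex-vertexOf v v∈D₂ = proj₂ (vertex-index v v∈D₂)

      split-vertexOf : ∀ v v∈D₂ → split v ≡ inj₁ (vertexOf v v∈D₂)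
      split-vertexOf v v∈D₂ = trans (cong split (sym (vertex-vertexOf v v∈D₂))) (split∘unsplit _)

      vertexOf-vertex : ∀ i v∈D₂ → vertexOf (vertex i) v∈D₂ ≡ i
      vertexOf-vertex i v∈D₂ = inj₁-injective (trans (sym (split-vertexOf _ v∈D₂)) (split∘unsplit (inj₁ i)))

      vertexOf-cong : ∀ {u v} u∈D₂ v∈D₂ → u ≡ v → vertexOf u u∈D₂ ≡ vertexOf v v∈D₂
      vertexOf-cong {u} u∈D₂ v∈D₂ refl = inj₁-injective (trans (sym (split-vertexOf u u∈D₂)) (split-vertexOf u v∈D₂))

      vertexOf-injective : ∀ {u v} u∈D₂ v∈D₂ → vertexOf u u∈D₂ ≡ vertexOf v v∈D₂ → u ≡ v
      vertexOf-injective {u} {v} u∈D₂ v∈D₂ p =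
        trans (sym (vertex-vertexOf u u∈D₂)) (trans (cong vertex p) (vertex-vertexOf v v∈D₂))

      edge-index : ∀ x → D₂ x ≡ false → ∃[ j ] midpoint j ≡ x
      edge-index x x∉D₂ with split x in eq
      ... | inj₂ j = j , trans (cong unsplit (sym eq)) (unsplit∘split x)
      ... | inj₁ i = ⊥-elim (true≢false (trans (sym (unsplit-true i))
                       (trans (cong D₂ (trans (sym (cong unsplit eq)) (unsplit∘split x))) x∉D₂)))

      edgeOf : ∀ x → D₂ x ≡ false → Fin #false
      edgeOf x x∉D₂ = proj₁ (edge-index x x∉D₂)

      midpoint-edgeOf : ∀ x x∉D₂ → midpoint (edgeOf x x∉D₂) ≡ x
      midpoint-edgeOf x x∉D₂ = proj₂ (edge-index x x∉D₂)

      edgeOf-unique : ∀ e x x∉D₂ → midpoint e ≡ x → e ≡ edgeOf x x∉D₂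
      edgeOf-unique e x x∉D₂ p = inj₂-injective (trans (sym (split∘unsplit (inj₂ e)))
        (trans (cong split (trans p (sym (midpoint-edgeOf x x∉D₂)))) (split∘unsplit _)))

      H : Multigraph
      H = record
        { m = #true ; k = #false
        ; ends = λ j → vertexOf (nb₁ (midpoint j) (unsplit-false j)) (nb₁∈D₂ _ _)
                     , vertexOf (nb₂ (midpoint j) (unsplit-false j)) (nb₂∈D₂ _ _)
        ; noLoop = λ j p → nb₁≢nb₂ _ _ (vertexOf-injective _ _ p) }

      Incident⇒adj : ∀ a a∈D₂ j → Incident H (vertexOf a a∈D₂) j → adj G (midpoint j) a ≡ true
      Incident⇒adj a a∈D₂ j (inj₁ p) = subst (λ z → adj G (midpoint j) z ≡ true) (vertexOf-injective _ _ p) (adj-nb₁ _ _)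
      Incident⇒adj a a∈D₂ j (inj₂ q) = subst (λ z → adj G (midpoint j) z ≡ true) (vertexOf-injective _ _ q) (adj-nb₂ _ _)

      adj⇒Incident : ∀ a a∈D₂ j → adj G (midpoint j) a ≡ true → Incident H (vertexOf a a∈D₂) j
      adj⇒Incident a a∈D₂ j h with only-nb₁-nb₂ (midpoint j) (unsplit-false j) a h
      ... | inj₁ p = inj₁ (vertexOf-cong _ _ (sym p))
      ... | inj₂ q = inj₂ (vertexOf-cong _ _ (sym q))

      adj⇒Joins : ∀ j a a∈D₂ b b∈D₂ → adj G (midpoint j) a ≡ true → adj G (midpoint j) b ≡ true → a ≢ b →
                  Joins H j (vertexOf a a∈D₂) (vertexOf b b∈D₂)
      adj⇒Joins j a a∈D₂ b b∈D₂ ja jb a≢b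
        with only-nb₁-nb₂ (midpoint j) (unsplit-false j) a ja | only-nb₁-nb₂ (midpoint j) (unsplit-false j) b jb
      ... | inj₁ p | inj₁ q = ⊥-elim (a≢b (trans p (sym q)))
      ... | inj₂ p | inj₂ q = ⊥-elim (a≢b (trans p (sym q)))
      ... | inj₁ p | inj₂ q = inj₁ (vertexOf-cong _ _ (sym p) , vertexOf-cong _ _ (sym q))
      ... | inj₂ p | inj₁ q = inj₂ (vertexOf-cong _ _ (sym q) , vertexOf-cong _ _ (sym p))

      adj-midpoint-vertex : ∀ j i → adj G (midpoint j) (vertex i) ≡ isEnd H i j
      adj-midpoint-vertex j i with isEnd H i j in end?
      ... | true  = Incident⇒adj _ (unsplit-true i) j
                      (subst (λ z → Incident H z j) (sym (vertexOf-vertex i (unsplit-true i))) (isEnd-sound H i j end?))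
      ... | false = ¬-not λ h → true≢false (trans (sym (isEnd-complete H i j
                      (subst (λ z → Incident H z j) (vertexOf-vertex i (unsplit-true i)) (adj⇒Incident _ (unsplit-true i) j h)))) end?)

      adj-unsplit : ∀ s t → adj G (unsplit s) (unsplit t) ≡ sAdj' H s t
      adj-unsplit (inj₁ i) (inj₁ i′) = same-side-non-adjacent _ _ (trans (unsplit-true i) (sym (unsplit-true i′)))
      adj-unsplit (inj₂ j) (inj₂ j′) = same-side-non-adjacent _ _ (trans (unsplit-false j) (sym (unsplit-false j′)))
      adj-unsplit (inj₁ i) (inj₂ j)  = trans (Graph.sym G _ _) (adj-midpoint-vertex j i)
      adj-unsplit (inj₂ j) (inj₁ i)  = adj-midpoint-vertex j i

      ≅subdivision : G ≅ subdivision H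
      ≅subdivision = record
        { to = λ v → join #true #false (split v)
        ; from = λ x → unsplit (splitAt #true x)
        ; from∘to = λ v → trans (cong unsplit (splitAt-join #true #false (split v))) (unsplit∘split v)
        ; to∘from = λ x → trans (cong (join #true #false) (split∘unsplit _)) (join-splitAt #true #false x)
        ; preserve = λ u v → trans (cong₂ (adj G) (sym (unsplit∘split u)) (sym (unsplit∘split v)))
            (trans (adj-unsplit (split u) (split v))
                   (sym (cong₂ (sAdj' H) (splitAt-join #true #false (split u)) (splitAt-join #true #false (split v))))) }

      adj-midpoint-edgeOf : ∀ x x∉D₂ {z} → adj G x z ≡ true → adj G (midpoint (edgeOf x x∉D₂)) z ≡ true
      adj-midpoint-edgeOf x x∉D₂ {z} = subst (λ x → adj G x z ≡ true) (sym (midpoint-edgeOf x x∉D₂))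

      -- A walk of G alternates between D₂ and its complement, so it steps through midpoints of edges of H.
      walk⇒MWalk : ∀ {a b} → Walk G a b → ∀ a∈D₂ b∈D₂ → MWalk H (vertexOf a a∈D₂) (vertexOf b b∈D₂)
      walk⇒MWalk {a} here a∈D₂ b∈D₂ = subst (MWalk H (vertexOf a a∈D₂)) (vertexOf-cong a∈D₂ b∈D₂ refl) here
      walk⇒MWalk (step ac here) a∈D₂ c∈D₂ = ⊥-elim (true≢false (trans (sym c∈D₂) (neighbour-of-D₂ ac a∈D₂)))
      walk⇒MWalk {a} {b} (step {w = c} ac (step {w = d} cd walk)) a∈D₂ b∈D₂ with a ≟ d
      ... | yes refl = subst (λ z → MWalk H z (vertexOf b b∈D₂)) (vertexOf-cong d∈D₂ a∈D₂ refl) (walk⇒MWalk walk d∈D₂ b∈D₂)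
        where
        d∈D₂ = neighbour-of-D₂ᶜ cd (neighbour-of-D₂ ac a∈D₂)
      ... | no a≢d = step (edgeOf c c∉D₂ , adj⇒Joins _ a a∈D₂ d d∈D₂
                             (adj-midpoint-edgeOf c c∉D₂ (adj-sym ac)) (adj-midpoint-edgeOf c c∉D₂ cd) a≢d)
                          (walk⇒MWalk walk d∈D₂ b∈D₂)
        where
        c∉D₂ = neighbour-of-D₂ ac a∈D₂
        d∈D₂ = neighbour-of-D₂ᶜ cd c∉D₂

      H-connected : MConnected H
      H-connected = 1≤#true , λ i j → subst₂ (MWalk H) (vertexOf-vertex i (unsplit-true i)) (vertexOf-vertex j (unsplit-true j))
        (walk⇒MWalk (proj₂ connected (vertex i) (vertex j)) (unsplit-true i) (unsplit-true j))
        where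
        some-D₂-vertex : ∃[ v ] D₂ v ≡ true
        some-D₂-vertex with D₂ (fromℕ< (proj₁ connected)) in v∈?D₂
        ... | true  = fromℕ< (proj₁ connected) , v∈?D₂
        ... | false = nb₁ _ v∈?D₂ , nb₁∈D₂ _ _
        1≤#true : 1 ≤ #true
        1≤#true = let (v , v∈D₂) = some-D₂-vertex in >-nonZero⁻¹ #true ⦃ nonZeroIndex (vertexOf v v∈D₂) ⦄

      IsLeaf⇒MLeaf : ∀ y y∈D₂ → IsLeaf G y → MLeaf H (vertexOf y y∈D₂)
      IsLeaf⇒MLeaf y y∈D₂ (x , yx , only-x) =
        edgeOf x x∉D₂ , adj⇒Incident y y∈D₂ _ (adj-midpoint-edgeOf x x∉D₂ (adj-sym yx)) ,
        λ e y∈e → edgeOf-unique e x x∉D₂ (only-x _ (adj-sym (Incident⇒adj y y∈D₂ e y∈e)))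
        where
        x∉D₂ = neighbour-of-D₂ yx y∈D₂

      corona-at : ∀ y y∈D₂ → IsLeaf G y ⊎ LeafAtDistanceTwo G y →
                  MLeaf H (vertexOf y y∈D₂) ⊎ ∃[ u ] (MAdjacent H (vertexOf y y∈D₂) u × MLeaf H u)
      corona-at y y∈D₂ (inj₁ y-leaf) = inj₁ (IsLeaf⇒MLeaf y y∈D₂ y-leaf)
      corona-at y y∈D₂ (inj₂ (x , u , yx , xu , u≢y , u-leaf)) =
        inj₂ (vertexOf u u∈D₂ , (edgeOf x x∉D₂ , adj⇒Joins _ y y∈D₂ u u∈D₂
               (adj-midpoint-edgeOf x x∉D₂ (adj-sym yx)) (adj-midpoint-edgeOf x x∉D₂ xu) (λ p → u≢y (sym p))) ,
             IsLeaf⇒MLeaf u u∈D₂ u-leaf)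
        where
        x∉D₂ = neighbour-of-D₂ yx y∈D₂
        u∈D₂ = neighbour-of-D₂ᶜ xu x∉D₂

      H-corona : IsCorona H
      H-corona i = subst (λ z → MLeaf H z ⊎ ∃[ u ] (MAdjacent H z u × MLeaf H u)) (vertexOf-vertex i (unsplit-true i))
                         (corona-at (vertex i) (unsplit-true i) (corona _ (unsplit-true i)))

  classification : Connected G → StarC₄OrCoronaSubdivision G
  classification connected with any? (λ x → (D₂ x Bool.≟ false) ×-dec branching? G x)
  ... | yes (x , x∉D₂ , branching) = inj₁ (branching⇒star connected x x∉D₂ branching)
  ... | no  ¬branching = inj₂ (two-neighbours-case (λ x x∉D₂ b → ¬branching (x , x∉D₂ , b)))
    where
    corona? : ∀ y → Dec (D₂ y ≡ true → IsLeaf G y ⊎ LeafAtDistanceTwo G y)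
    corona? y = (D₂ y Bool.≟ true) →-dec (isLeaf? G y ⊎-dec leafAtDistanceTwo? G y)
    two-neighbours-case : (∀ x → D₂ x ≡ false → ¬ Branching G x) →
                          (G ≅ C4) ⊎ (∃[ H ] (MConnected H × IsCorona H × G ≅ subdivision H))
    two-neighbours-case ¬branching with all? corona?
    ... | yes corona = inj₂ (H , H-connected , H-corona , ≅subdivision)
      where open TwoNeighbours.Corona connected ¬branching corona
    ... | no ¬corona with ¬∀⟶∃¬ n _ corona? ¬corona
    ...   | y , ¬corona-y with D₂ y in y∈?D₂
    ...     | false = ⊥-elim (¬corona-y λ ())
    ...     | true  = inj₁ (TwoNeighbours.non-corona⇒C₄ connected ¬branching y y∈?D₂ λ c → ¬corona-y λ _ → c)

StarC₄OrCoronaSubdivision⇒edgeMinimal : ∀ {n} {G : Graph n} → StarC₄OrCoronaSubdivision G → EdgeMinimal G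
StarC₄OrCoronaSubdivision⇒edgeMinimal (inj₁ (k , 2≤k , G≅star)) = ≅-EdgeMinimal G≅star (star-edgeMinimal k 2≤k)
StarC₄OrCoronaSubdivision⇒edgeMinimal (inj₂ (inj₁ G≅C₄))         = ≅-EdgeMinimal G≅C₄ C₄-edgeMinimal
StarC₄OrCoronaSubdivision⇒edgeMinimal (inj₂ (inj₂ (H , _ , corona , G≅S[H]))) =
  ≅-EdgeMinimal G≅S[H] (Subdivision.edgeMinimal H corona)

mainTheorem4 : ∀ (n : ℕ) (G : Graph n) → Connected G →
    (MinimalDD2Graph G ⇔
    ((∃[ k ] (2 ≤ k × G ≅ star k))
    ⊎ (G ≅ C4)
    ⊎ (∃[ H ] (MConnected H × IsCorona H × G ≅ subdivision H))))
mainTheorem4 n G connected = mk⇔ forward backward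
  where
  forward : MinimalDD2Graph G → StarC₄OrCoronaSubdivision G
  forward minimal@(_ , (D , D₂ , pair) , _) =
    Critical.classification G (proj₂ (minimal⇒edgeMinimal G minimal)) D D₂ pair connected
  backward : StarC₄OrCoronaSubdivision G → MinimalDD2Graph G
  backward shape = edgeMinimal⇒minimal G connected (StarC₄OrCoronaSubdivision⇒edgeMinimal shape)
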